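{- Let $S=(w_1,\ldots,w_{3m})$ be a list of positive integers and $b$ a positive integer. Let $\mathcal{P}=(X_1,\ldots,X_l)$ be a path decomposition of width $4$ of $G(S,b)$, and let $c_1,\ldots,c_{m+1}$ be such that $X_{c_i}$ contains all vertices of $K_5^i$ for each $i=1,\ldots,m+1$. Then $c_1<c_2<\cdots<c_{m+1}$ or $c_1>c_2>\cdots>c_{m+1}$.
   Context: A path decomposition of a graph $G$ is a sequence $(X_1,\ldots,X_l)$ of subsets of $V(G)$ such that $\bigcup_i X_i=V(G)$; every edge has both endpoints in some $X_i$; and $X_i\cap X_k\subseteq X_j$ whenever $i\leq j\leq k$; width is $\max_i|X_i|-1$. The graph $G(S,b)$: for each $i\in\{1,\ldots,3m\}$, $H_i$ is obtained from pairwise disjoint cliques $K_3^{i,q}$ ($q=1,\ldots,w_i$) and $K_4^{i,q}$ ($q=1,\ldots,w_i-1$) by identifying, for each $q\leq w_i-1$, two different vertices of $K_4^{i,q}$ with a vertex of $K_3^{i,q}$ and a vertex of $K_3^{i,q+1}$ respectively, such that each vertex of each $K_3^{i,q}$ is identified with at most one vertex of another clique. $H_{m,b}$ is obtained from disjoint copies $K_5^1,\ldots,K_5^{m+1}$ of $K_5$ and disjoint copies $P_b^1,\ldots,P_b^m$ of the path with $b$ edges by identifying one endpoint of $P_b^j$ with a vertex of $K_5^j$ and the other with a vertex of $K_5^{j+1}$, so that no vertex of any $K_5^j$ is identified with endpoints of two different paths. $G(S,b)$ is the disjoint union of $H_1,\ldots,H_{3m},H_{m,b}$. -}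

module Defs where

open import Data.Nat using (ℕ; zero; suc; _+_; _*_; _≤_; _<_; s≤s; z≤n; _≟_)
open import Data.Nat.Properties using (<-trans; n<1+n; ≤∧≢⇒<; <⇒≤)
open import Data.Fin using (Fin; toℕ; inject₁) renaming (_<_ to _<ᶠ_)
import Data.Fin as F
open import Data.List using (List; length)
open import Data.List.Membership.Propositional using (_∈_)
open import Data.List.Relation.Unary.Unique.Propositional using (Unique)
open import Data.Product using (Σ; _×_; ∃)
open import Data.Sum using (_⊎_)
open import Relation.Binary.PropositionalEquality using (_≡_; _≢_)
open import Relation.Nullary using (yes; no)

-- Bags are finite sets of vertices, represented
-- as duplicate-free lists; the bags are indexed by Fin l (0-based).

record PathDecomposition (V : Set) (Adj : V → V → Set) : Set₁ where
  field
    l       : ℕ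
    X       : Fin l → List V
    unique  : ∀ i → Unique (X i)
    cover   : ∀ v → ∃ λ i → v ∈ X i
    edges   : ∀ u v → Adj u v → ∃ λ i → (u ∈ X i × v ∈ X i)
    interp  : ∀ (i j k : Fin l) → toℕ i ≤ toℕ j → toℕ j ≤ toℕ k →
              ∀ v → v ∈ X i → v ∈ X k → v ∈ X j

-- width = max_i |X_i| - 1 ; "width w" means max_i |X_i| = w + 1
HasWidth : ∀ {V Adj} → PathDecomposition V Adj → ℕ → Set
HasWidth P w = (∀ i → length (X i) ≤ suc w) × ∃ λ i → length (X i) ≡ suc w
  where open PathDecomposition P

-- Vertices (all indices 0-based; bounds are irrelevant arguments):
--   tri i q r   : vertex r of the triangle K_3^{i,q}            (q < w_i)
--   k4 i q s    : the two private vertices of K_4^{i,q}          (q+1 < w_i)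
--                 (its other two vertices are tri i q 1 and tri i (q+1) 0)
--   k5 j s      : vertex s of K_5^j                             (j ≤ m)
--   pth j k     : internal vertex k (0<k<b) of the path P_b^j   (j < m)
--                 (its endpoints are k5 j 0 and k5 (j+1) 1)

module _ (m : ℕ) (S : Fin (3 * m) → ℕ) (b : ℕ) where

  data GV : Set where
    tri : (i : Fin (3 * m)) (q : ℕ) .(q<w : q < S i) → Fin 3 → GV
    k4  : (i : Fin (3 * m)) (q : ℕ) .(q+1<w : suc q < S i) → Fin 2 → GV
    k5  : Fin (suc m) → Fin 5 → GV
    pth : Fin m → (k : ℕ) .(0<k : 0 < k) .(k<b : k < b) → GV

  k4vert : (i : Fin (3 * m)) (q : ℕ) .(p : suc q < S i) → Fin 4 → GV
  k4vert i q p F.zero                         = tri i q (<-trans (n<1+n q) p) (F.suc F.zero)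
  k4vert i q p (F.suc F.zero)                 = tri i (suc q) p F.zero
  k4vert i q p (F.suc (F.suc F.zero))         = k4 i q p F.zero
  k4vert i q p (F.suc (F.suc (F.suc F.zero))) = k4 i q p (F.suc F.zero)

  pathv : Fin m → (k : ℕ) → .(k ≤ b) → GV
  pathv j zero    _ = k5 (inject₁ j) F.zero
  pathv j (suc k) p with suc k ≟ b
  ... | yes _ = k5 (F.suc j) (F.suc F.zero)
  ... | no ne = pth j (suc k) (s≤s z≤n) (≤∧≢⇒< p ne)

  data GE : GV → GV → Set where
    e3 : ∀ i q .(p : q < S i) (r r' : Fin 3) → r ≢ r' → GE (tri i q p r) (tri i q p r')
    e4 : ∀ i q .(p : suc q < S i) (s s' : Fin 4) → s ≢ s' → GE (k4vert i q p s) (k4vert i q p s')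
    e5 : ∀ j (s s' : Fin 5) → s ≢ s' → GE (k5 j s) (k5 j s')
    eP : ∀ j k (p : suc k ≤ b) → GE (pathv j k (<⇒≤ p)) (pathv j (suc k) p)

  GAdj : GV → GV → Set
  GAdj u v = GE u v ⊎ GE v u

module Submission where

open import Defs
open import Data.Nat using (ℕ; zero; suc; _*_; _<_; _>_; _≤_; z≤n; s≤s; _≟_)
open import Data.Nat.Properties using (<-cmp; ≤-total; ≤-refl; ≤-trans; <⇒≤; 1+n≰n; 1+n≢n)
open import Data.Fin using (Fin; toℕ; inject₁; zero; suc)
open import Data.Fin.Properties using (toℕ-injective; toℕ-inject₁; suc-injective; injective⇒≤)
open import Data.Vec.Functional using (_∷_)
open import Data.List using (List; length; lookup)
open import Data.List.Relation.Unary.Any using (index)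
open import Data.List.Relation.Unary.Any.Properties using (lookup-index)
open import Data.List.Membership.Propositional using (_∈_; _∉_)
open import Data.Sum using (_⊎_; inj₁; inj₂)
open import Data.Product using (∃; _×_; _,_; proj₁)
open import Data.Empty using (⊥-elim)
open import Function using (_∘_)
open import Function.Definitions using (Injective)
open import Relation.Nullary using (¬_; yes; no)
open import Relation.Binary.Definitions using (tri<; tri≈; tri>)
open import Relation.Binary.PropositionalEquality

-- A bag of a width-4 decomposition containing K₅^j holds nothing else, so the
-- bags X (c j) are distinct and X (c j) contains no vertex of a path P_b^j' with
-- j ∉ {j', j'+1}.  Since P_b^j' runs from K₅^j' to K₅^(j'+1), every bag between
-- c j' and c (j'+1) meets it, so no c j lies between two consecutive values.  A
-- sequence of distinct numbers in which no term lies between two consecutive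
-- terms other than its neighbours is strictly monotone.

Between : ℕ → ℕ → ℕ → Set
Between a t d = (a ≤ t × t ≤ d) ⊎ (d ≤ t × t ≤ a)

Between-split : ∀ {a t d} f → Between a t d → Between a t f ⊎ Between f t d
Between-split {t = t} f (inj₁ (a≤t , t≤d)) with ≤-total t f
... | inj₁ t≤f = inj₁ (inj₁ (a≤t , t≤f))
... | inj₂ f≤t = inj₂ (inj₁ (f≤t , t≤d))
Between-split {t = t} f (inj₂ (d≤t , t≤a)) with ≤-total t f
... | inj₁ t≤f = inj₂ (inj₂ (d≤t , t≤f))
... | inj₂ f≤t = inj₁ (inj₂ (f≤t , t≤a))

StrictlyIncreasing StrictlyDecreasing : ∀ {m} → (Fin (suc m) → ℕ) → Set
StrictlyIncreasing h = ∀ j → h (inject₁ j) < h (suc j)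
StrictlyDecreasing h = ∀ j → h (inject₁ j) > h (suc j)

<-of-next-< : ∀ {a b c} → a ≢ b → b < c → ¬ Between b a c → ¬ Between a c b → a < b
<-of-next-< {a} {b} {c} a≢b b<c a∉[b,c] c∉[a,b] with <-cmp a b
... | tri< a<b _ _ = a<b
... | tri≈ _ a≡b _ = ⊥-elim (a≢b a≡b)
... | tri> _ _ b<a with ≤-total a c
...   | inj₁ a≤c = ⊥-elim (a∉[b,c] (inj₁ (<⇒≤ b<a , a≤c)))
...   | inj₂ c≤a = ⊥-elim (c∉[a,b] (inj₂ (<⇒≤ b<c , c≤a)))

>-of-next-> : ∀ {a b c} → a ≢ b → b > c → ¬ Between b a c → ¬ Between a c b → a > b
>-of-next-> {a} {b} {c} a≢b b>c a∉[b,c] c∉[a,b] with <-cmp a b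
... | tri> _ _ a>b = a>b
... | tri≈ _ a≡b _ = ⊥-elim (a≢b a≡b)
... | tri< a<b _ _ with ≤-total a c
...   | inj₁ a≤c = ⊥-elim (c∉[a,b] (inj₁ (a≤c , <⇒≤ b>c)))
...   | inj₂ c≤a = ⊥-elim (a∉[b,c] (inj₂ (c≤a , <⇒≤ a<b)))

monotone-if-no-term-between-neighbours : ∀ {m} (h : Fin (suc m) → ℕ) →
  (∀ j → h (inject₁ j) ≢ h (suc j)) →
  (∀ j k → k ≢ inject₁ j → k ≢ suc j → ¬ Between (h (inject₁ j)) (h k) (h (suc j))) →
  StrictlyIncreasing h ⊎ StrictlyDecreasing h
monotone-if-no-term-between-neighbours {zero} h _ _ = inj₁ λ ()
monotone-if-no-term-between-neighbours {suc zero} h distinct _ with <-cmp (h zero) (h (suc zero))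
... | tri< h₀<h₁ _ _ = inj₁ λ { zero → h₀<h₁ }
... | tri≈ _ h₀≡h₁ _ = ⊥-elim (distinct zero h₀≡h₁)
... | tri> _ _ h₀>h₁ = inj₂ λ { zero → h₀>h₁ }
monotone-if-no-term-between-neighbours {suc (suc m)} h distinct apart
  with monotone-if-no-term-between-neighbours (h ∘ suc) (distinct ∘ suc)
         (λ j k k≢j k≢j+1 → apart (suc j) (suc k) (k≢j ∘ suc-injective) (k≢j+1 ∘ suc-injective))
... | inj₁ increasing = inj₁ λ
  { zero    → <-of-next-< (distinct zero) (increasing zero)
                (apart (suc zero) zero (λ ()) (λ ())) (apart zero (suc (suc zero)) (λ ()) (λ ()))
  ; (suc j) → increasing j }
... | inj₂ decreasing = inj₂ λ
  { zero    → >-of-next-> (distinct zero) (decreasing zero)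
                (apart (suc zero) zero (λ ()) (λ ())) (apart zero (suc (suc zero)) (λ ()) (λ ()))
  ; (suc j) → decreasing j }

∷-injective : ∀ {A : Set} {n} {v : A} {κ : Fin n → A} →
  (∀ s → v ≢ κ s) → Injective _≡_ _≡_ κ → Injective _≡_ _≡_ (v ∷ κ)
∷-injective v∉κ κ-inj {zero}  {zero}  _  = refl
∷-injective v∉κ κ-inj {zero}  {suc s} eq = ⊥-elim (v∉κ s eq)
∷-injective v∉κ κ-inj {suc s} {zero}  eq = ⊥-elim (v∉κ s (sym eq))
∷-injective v∉κ κ-inj {suc s} {suc t} eq = cong suc (κ-inj eq)

injective-image⇒≤length : ∀ {A : Set} {n} {xs : List A} (κ : Fin n → A) →
  Injective _≡_ _≡_ κ → (∀ s → κ s ∈ xs) → n ≤ length xs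
injective-image⇒≤length {xs = xs} κ κ-inj κ∈xs = injective⇒≤ index-injective
  where
    index-injective : Injective _≡_ _≡_ (index ∘ κ∈xs)
    index-injective {s} {t} eq = κ-inj (begin
      κ s                       ≡⟨ lookup-index (κ∈xs s) ⟩
      lookup xs (index (κ∈xs s)) ≡⟨ cong (lookup xs) eq ⟩
      lookup xs (index (κ∈xs t)) ≡⟨ lookup-index (κ∈xs t) ⟨
      κ t                       ∎)
      where open ≡-Reasoning

∉-full : ∀ {A : Set} {n} {xs : List A} {v : A} (κ : Fin n → A) →
  Injective _≡_ _≡_ κ → (∀ s → κ s ∈ xs) → length xs ≤ n → (∀ s → v ≢ κ s) → v ∉ xs
∉-full {xs = xs} {v} κ κ-inj κ∈xs |xs|≤n v∉κ v∈xs =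
  1+n≰n (≤-trans (injective-image⇒≤length (v ∷ κ) (∷-injective v∉κ κ-inj) v∷κ∈xs) |xs|≤n)
  where
    v∷κ∈xs : ∀ s → (v ∷ κ) s ∈ xs
    v∷κ∈xs zero    = v∈xs
    v∷κ∈xs (suc s) = κ∈xs s

module _ {V : Set} {Adj : V → V → Set} (P : PathDecomposition V Adj) where
  open PathDecomposition P

  interp-between : ∀ {i j k v} → Between (toℕ i) (toℕ j) (toℕ k) → v ∈ X i → v ∈ X k → v ∈ X j
  interp-between {i} {j} {k} (inj₁ (i≤j , j≤k)) v∈Xi v∈Xk = interp i j k i≤j j≤k _ v∈Xi v∈Xk
  interp-between {i} {j} {k} (inj₂ (k≤j , j≤i)) v∈Xi v∈Xk = interp k j i k≤j j≤i _ v∈Xk v∈Xi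

  -- Walks are encoded like pathv in Defs, so that each path P_b^j is one.
  walk-meets-bags-between : ∀ n (w : (k : ℕ) → .(k ≤ n) → V) →
    (∀ k (p : suc k ≤ n) → Adj (w k (<⇒≤ p)) (w (suc k) p)) →
    ∀ {i j k} → Between (toℕ i) (toℕ j) (toℕ k) → w 0 z≤n ∈ X i → w n ≤-refl ∈ X k →
    ∃ λ t → ∃ λ (p : t ≤ n) → w t p ∈ X j
  walk-meets-bags-between zero w _ between w₀∈Xi w₀∈Xk = 0 , z≤n , interp-between between w₀∈Xi w₀∈Xk
  walk-meets-bags-between (suc n) w step {i} {j} {k} between w₀∈Xi wₙ∈Xk
    with edges _ _ (step 0 (s≤s z≤n))
  ... | f , w₀∈Xf , w₁∈Xf with Between-split (toℕ f) between
  ...   | inj₁ i-j-f = 0 , z≤n , interp-between i-j-f w₀∈Xi w₀∈Xf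
  ...   | inj₂ f-j-k with walk-meets-bags-between n (λ t p → w (suc t) (s≤s p))
                            (λ t p → step (suc t) (s≤s p)) f-j-k w₁∈Xf wₙ∈Xk
  ...     | t , p , wₜ₊₁∈Xj = suc t , s≤s p , wₜ₊₁∈Xj

module _ (m : ℕ) (S : Fin (3 * m) → ℕ) where

  k5-injective : ∀ {b} j → Injective _≡_ _≡_ (k5 {m} {S} {b} j)
  k5-injective j refl = refl

  pathv-last : ∀ {b} j .(p : b ≤ b) → 0 < b → pathv m S b j b p ≡ k5 (suc j) (suc zero)
  pathv-last {suc b} j p _ with suc b ≟ suc b
  ... | yes _ = refl
  ... | no b≢b = ⊥-elim (b≢b refl)

  pathv-∉-other-k5 : ∀ {b} j {j′} → j′ ≢ inject₁ j → j′ ≢ suc j →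
    ∀ k .(p : k ≤ b) s → pathv m S b j k p ≢ k5 j′ s
  pathv-∉-other-k5 j j′≢j j′≢j+1 zero p s refl = j′≢j refl
  pathv-∉-other-k5 {b} j j′≢j j′≢j+1 (suc k) p s eq with suc k ≟ b
  pathv-∉-other-k5 j j′≢j j′≢j+1 (suc k) p s refl | yes _ = j′≢j+1 refl
  pathv-∉-other-k5 j j′≢j j′≢j+1 (suc k) p s () | no _

  module _ {b : ℕ} (P : PathDecomposition (GV m S b) (GAdj m S b)) (width : HasWidth P 4)
           (c : Fin (suc m) → Fin (PathDecomposition.l P))
           (K₅⊆Xc : ∀ j s → k5 j s ∈ PathDecomposition.X P (c j)) where
    open PathDecomposition P

    only-K₅-in-bag : ∀ j {v} → (∀ s → v ≢ k5 j s) → v ∉ X (c j)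
    only-K₅-in-bag j = ∉-full (k5 j) (k5-injective j) (K₅⊆Xc j) (proj₁ width (c j))

    bags-distinct : ∀ {j j′} → j ≢ j′ → toℕ (c j) ≢ toℕ (c j′)
    bags-distinct {j} {j′} j≢j′ cj≡cj′ = only-K₅-in-bag j (λ { s refl → j≢j′ refl })
      (subst (λ i → k5 j′ zero ∈ X i) (sym (toℕ-injective cj≡cj′)) (K₅⊆Xc j′ zero))

    bag-not-between-path-ends : 0 < b → ∀ j {j′} → j′ ≢ inject₁ j → j′ ≢ suc j →
      ¬ Between (toℕ (c (inject₁ j))) (toℕ (c j′)) (toℕ (c (suc j)))
    bag-not-between-path-ends 0<b j {j′} j′≢j j′≢j+1 between
      with walk-meets-bags-between P b (pathv m S b j) (λ k p → inj₁ (eP j k p)) between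
             (K₅⊆Xc (inject₁ j) zero)
             (subst (λ v → v ∈ X (c (suc j))) (sym (pathv-last j ≤-refl 0<b)) (K₅⊆Xc (suc j) (suc zero)))
    ... | k , p , pₖ∈Xcj′ = only-K₅-in-bag j′ (pathv-∉-other-k5 j j′≢j j′≢j+1 k p) pₖ∈Xcj′

inject₁≢suc : ∀ {m} (j : Fin m) → inject₁ j ≢ suc j
inject₁≢suc j eq = 1+n≢n (trans (sym (cong toℕ eq)) (toℕ-inject₁ j))

lemma6 : (m : ℕ) (S : Fin (3 * m) → ℕ) → (∀ i → 0 < S i) → (b : ℕ) → 0 < b →
         (P : PathDecomposition (GV m S b) (GAdj m S b)) → HasWidth P 4 →
         (c : Fin (suc m) → Fin (PathDecomposition.l P)) →
         (∀ j s → k5 j s ∈ PathDecomposition.X P (c j)) →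
         (∀ (j : Fin m) → toℕ (c (inject₁ j)) < toℕ (c (Fin.suc j)))
         ⊎ (∀ (j : Fin m) → toℕ (c (inject₁ j)) > toℕ (c (Fin.suc j)))
lemma6 m S _ b 0<b P width c K₅⊆Xc =
  monotone-if-no-term-between-neighbours (toℕ ∘ c)
    (λ j → bags-distinct m S P width c K₅⊆Xc (inject₁≢suc j))
    (λ j _ → bag-not-between-path-ends m S P width c K₅⊆Xc 0<b j)
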